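{- Let $(X,\leq,\top,\ominus)$ be a D-poset with canonical sum $\oplus$, and let $i<j<k$ be natural numbers. For $m\geq 0$ let $C_m$ be the set of monotone functions $[2m]\to X$ ($[m]=\{0<\dots<m\}$). For $p<q$ and $d=q-p$ define $s_p,t_p:C_q\to C_p$, $Id_p:C_p\to C_q$ and the partial composition $c_p:C_q\times C_q\to C_q$ by $s_p(f)(r)=f(r)$ for $r\leq p$, $s_p(f)(r)=f(r+2d)$ for $p<r\leq 2p$; $t_p(f)(r)=f(r)$ for $r<p$, $t_p(f)(r)=f(r+2d)$ for $p\leq r\leq 2p$; $Id_p(a)(r)=a(r)$ for $r<p$, $Id_p(a)(r)=a(p)$ for $p\leq r\leq p+2d$, $Id_p(a)(r)=a(r-2d)$ for $r>p+2d$; and, for $s_p(f)=t_p(g)$, $c_p(f,g)(r)=g(r)$ for $r\leq p$, $c_p(f,g)(r)=(f(r)\ominus f(p))\oplus g(r)$ for $p<r<p+2d$, $c_p(f,g)(r)=f(r)$ for $r\geq p+2d$. Then there is a strict 2-category whose 0-cells, 1-cells and 2-cells are the elements of $C_i$, $C_j$ and $C_k$ respectively; in which sources, targets and identities of 1-cells are given by $s_i,t_i,Id_i$ (with $q=j$), and sources, targets and identities of 2-cells by $s_j,t_j,Id_j$ (with $q=k$); whose vertical composition of 2-cells is $c_j$ on $C_k$; and whose horizontal composition is $c_i$ (on $C_j$ for 1-cells and on $C_k$ for 2-cells), $c_i$ being functorial with respect to the category structure on hom-sets given by $j$ and $k$.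
   Context: A D-poset $(X,\leq,\top,\ominus)$ is a poset with top element $\top$ and a partial binary operation $\ominus$ such that: (1) $y\ominus x$ is defined precisely when $x\leq y$; (2) whenever $x\leq y$, $y\ominus x\leq y$ and $y\ominus(y\ominus x)=x$; (3) if $z\leq y\leq x$ then $x\ominus y\leq x\ominus z$ and $(x\ominus z)\ominus(x\ominus y)=y\ominus z$. The canonical sum: $a\oplus b$ is defined iff there is $c$ with $c\ominus b=a$ (equivalently iff $b\leq\top\ominus a$), and then $a\oplus b:=c$. A strict 2-category is a category enriched in $\mathbf{Cat}$ (composition associative and unital on the nose). -}

module Defs where

open import Level using (Level; _⊔_) renaming (suc to lsuc)
open import Data.Nat using (ℕ; _+_; _*_; _∸_; _≤ᵇ_; _<ᵇ_) renaming (_≤_ to _≤ℕ_; _<_ to _<ℕ_)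
open import Data.Bool using (if_then_else_)
open import Data.Product using (Σ; _×_; ∃)
open import Relation.Binary.Core using (Rel)
open import Relation.Binary.Structures using (IsPartialOrder)
open import Relation.Binary.PropositionalEquality using (_≡_)

record DPoset (c ℓ : Level) : Set (lsuc (c ⊔ ℓ)) where
  field
    Carrier        : Set c
    _≤_            : Rel Carrier ℓ
    isPartialOrder : IsPartialOrder _≡_ _≤_
    ≤-irrelevant   : ∀ {x y} (p q : x ≤ y) → p ≡ q
    ⊤              : Carrier
    ⊤-max          : ∀ x → x ≤ ⊤
    minus          : (y x : Carrier) → x ≤ y → Carrier

  open IsPartialOrder isPartialOrder public using (refl; trans; antisym)

  field
    minus-≤        : ∀ {x y} (p : x ≤ y) → minus y x p ≤ y
    minus-invol    : ∀ {x y} (p : x ≤ y) → minus y (minus y x p) (minus-≤ p) ≡ x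
    minus-anti     : ∀ {x y z} (zy : z ≤ y) (yx : y ≤ x) →
                     minus x y yx ≤ minus x z (trans zy yx)
    minus-assoc    : ∀ {x y z} (zy : z ≤ y) (yx : y ≤ x) →
                     minus (minus x z (trans zy yx)) (minus x y yx) (minus-anti zy yx)
                       ≡ minus y z zy

  -- canonical sum, as a relation: "a ⊕ b is defined and equals c"
  -- (a ⊕ b := c where c ⊖ b = a)
  IsSum : Carrier → Carrier → Carrier → Set (c ⊔ ℓ)
  IsSum a b s = Σ (b ≤ s) λ h → minus s b h ≡ a

-- The cells C_m : monotone functions [2m] → X.
-- A function [2m] → X is represented by a function ℕ → X of which only
-- the values at 0,…,2m matter (equality of cells is pointwise on [2m]).

module Cells {c ℓ} (D : DPoset c ℓ) where
  open DPoset D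

  record Cell (m : ℕ) : Set (c ⊔ ℓ) where
    constructor cell
    field
      fun  : ℕ → Carrier
      mono : ∀ {r r'} → r ≤ℕ r' → r' ≤ℕ 2 * m → fun r ≤ fun r'
  open Cell public

  _≈[_]_ : ∀ {m} → Cell m → ℕ → Cell m → Set c
  f ≈[ m ] g = ∀ r → r ≤ℕ 2 * m → fun f r ≡ fun g r

  sRaw : (p q : ℕ) → (ℕ → Carrier) → (ℕ → Carrier)
  sRaw p q f r = if r ≤ᵇ p then f r else f (r + 2 * (q ∸ p))

  tRaw : (p q : ℕ) → (ℕ → Carrier) → (ℕ → Carrier)
  tRaw p q f r = if r <ᵇ p then f r else f (r + 2 * (q ∸ p))

  IdRaw : (p q : ℕ) → (ℕ → Carrier) → (ℕ → Carrier)
  IdRaw p q a r =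
    if r <ᵇ p then a r
    else (if r ≤ᵇ p + 2 * (q ∸ p) then a p else a (r ∸ 2 * (q ∸ p)))

  CompSpec : (p q : ℕ) → (f g h : ℕ → Carrier) → ℕ → Set (c ⊔ ℓ)
  CompSpec p q f g h r =
      (r ≤ℕ p → h r ≡ g r)
    × (p <ℕ r → r <ℕ p + 2 * (q ∸ p) →
         Σ (f p ≤ f r) λ fp≤fr → IsSum (minus (f r) (f p) fp≤fr) (g r) (h r))
    × (p + 2 * (q ∸ p) ≤ℕ r → h r ≡ f r)

-- Strict 2-categories (categories enriched in Cat), in globular form,
-- on given sets of 0-, 1- and 2-cells, each equipped with an equality.

record IsStrict2Cat {o a b e₀ e₁ e₂ : Level}
       (O : Set o) (A : Set a) (B : Set b)
       (_≈₀_ : Rel O e₀) (_≈₁_ : Rel A e₁) (_≈₂_ : Rel B e₂)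
       : Set (o ⊔ a ⊔ b ⊔ e₀ ⊔ e₁ ⊔ e₂) where
  field
    ≈₀-isEquivalence : Relation.Binary.Structures.IsEquivalence _≈₀_
    ≈₁-isEquivalence : Relation.Binary.Structures.IsEquivalence _≈₁_
    ≈₂-isEquivalence : Relation.Binary.Structures.IsEquivalence _≈₂_

    src₁ tgt₁ : A → O
    id₁       : O → A
    src₂ tgt₂ : B → A
    id₂       : A → B
    comp₁     : (f g : A) → src₁ f ≈₀ tgt₁ g → A
    vcomp     : (α β : B) → src₂ α ≈₁ tgt₂ β → B
    hcomp     : (α β : B) → src₁ (src₂ α) ≈₀ tgt₁ (src₂ β) → B

    -- all operations respect equality (and do not depend on the proofs)
    src₁-cong : ∀ {f g} → f ≈₁ g → src₁ f ≈₀ src₁ g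
    tgt₁-cong : ∀ {f g} → f ≈₁ g → tgt₁ f ≈₀ tgt₁ g
    id₁-cong  : ∀ {x y} → x ≈₀ y → id₁ x ≈₁ id₁ y
    src₂-cong : ∀ {α β} → α ≈₂ β → src₂ α ≈₁ src₂ β
    tgt₂-cong : ∀ {α β} → α ≈₂ β → tgt₂ α ≈₁ tgt₂ β
    id₂-cong  : ∀ {f g} → f ≈₁ g → id₂ f ≈₂ id₂ g
    comp₁-cong : ∀ {f f' g g'} p p' → f ≈₁ f' → g ≈₁ g' →
                 comp₁ f g p ≈₁ comp₁ f' g' p'
    vcomp-cong : ∀ {α α' β β'} p p' → α ≈₂ α' → β ≈₂ β' →
                 vcomp α β p ≈₂ vcomp α' β' p'
    hcomp-cong : ∀ {α α' β β'} p p' → α ≈₂ α' → β ≈₂ β' →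
                 hcomp α β p ≈₂ hcomp α' β' p'

    glob-src : ∀ α → src₁ (src₂ α) ≈₀ src₁ (tgt₂ α)
    glob-tgt : ∀ α → tgt₁ (src₂ α) ≈₀ tgt₁ (tgt₂ α)

    src₁-id₁ : ∀ x → src₁ (id₁ x) ≈₀ x
    tgt₁-id₁ : ∀ x → tgt₁ (id₁ x) ≈₀ x
    src₂-id₂ : ∀ f → src₂ (id₂ f) ≈₁ f
    tgt₂-id₂ : ∀ f → tgt₂ (id₂ f) ≈₁ f

    src₁-comp₁ : ∀ f g p → src₁ (comp₁ f g p) ≈₀ src₁ g
    tgt₁-comp₁ : ∀ f g p → tgt₁ (comp₁ f g p) ≈₀ tgt₁ f
    comp₁-assoc : ∀ f g h p q r s →
                  comp₁ (comp₁ f g p) h q ≈₁ comp₁ f (comp₁ g h r) s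
    comp₁-idˡ : ∀ f p → comp₁ (id₁ (tgt₁ f)) f p ≈₁ f
    comp₁-idʳ : ∀ f p → comp₁ f (id₁ (src₁ f)) p ≈₁ f

    src₂-vcomp : ∀ α β p → src₂ (vcomp α β p) ≈₁ src₂ β
    tgt₂-vcomp : ∀ α β p → tgt₂ (vcomp α β p) ≈₁ tgt₂ α
    vcomp-assoc : ∀ α β γ p q r s →
                  vcomp (vcomp α β p) γ q ≈₂ vcomp α (vcomp β γ r) s
    vcomp-idˡ : ∀ α p → vcomp (id₂ (tgt₂ α)) α p ≈₂ α
    vcomp-idʳ : ∀ α p → vcomp α (id₂ (src₂ α)) p ≈₂ α

    -- horizontal composition: a functor hom(y,z) × hom(x,y) → hom(x,z)
    src₂-hcomp : ∀ α β p q → src₂ (hcomp α β p) ≈₁ comp₁ (src₂ α) (src₂ β) q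
    tgt₂-hcomp : ∀ α β p q → tgt₂ (hcomp α β p) ≈₁ comp₁ (tgt₂ α) (tgt₂ β) q
    hcomp-id₂  : ∀ f g p q → hcomp (id₂ f) (id₂ g) p ≈₂ id₂ (comp₁ f g q)
    interchange : ∀ α α' β β' u v w x y z →
                  hcomp (vcomp α α' u) (vcomp β β' v) w
                    ≈₂ vcomp (hcomp α β x) (hcomp α' β' y) z
    hcomp-assoc : ∀ α β γ p q r s →
                  hcomp (hcomp α β p) γ q ≈₂ hcomp α (hcomp β γ r) s
    hcomp-idˡ : ∀ α p → hcomp (id₂ (id₁ (tgt₁ (src₂ α)))) α p ≈₂ α
    hcomp-idʳ : ∀ α p → hcomp α (id₂ (id₁ (src₁ (src₂ α)))) p ≈₂ α

module Submission where

-- Sources, targets and identities are precompositions with monotone index maps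
-- σ, τ : [2p] → [2q] and ψ : [2q] → [2p], ψ r = (r ⊓ p) ⊔ (r ∸ 2d); so every
-- globular law reduces to an identity between index maps.  The composite
-- c_p(f,g) equals g up to p, f from p + 2d on, and (f r ⊖ f p) ⊕ g r in between,
-- a sum that exists because g r ≤ g (p + 2d) = f p.  Associativity, units and the
-- interchange law then follow from the partial commutative monoid laws of ⊕ in a
-- D-poset (cancellation, associativity and the medial law), while horizontal
-- composition is compatible with sources, targets and identities because c_i
-- commutes with reindexing along face and degeneracy maps that preserve the
-- three regions of the composite.

open import Defs
open import Level using (Level)
open import Function using (_∘_; case_of_)
open import Data.Bool using (true; false; if_then_else_; T)
open import Data.Bool.Properties using (if-float)
open import Data.Empty using (⊥-elim)
open import Data.Product using (Σ; _×_; _,_; proj₁; proj₂)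
open import Data.Sum using (_⊎_; inj₁; inj₂; [_,_])
open import Data.Nat
  using (ℕ; _+_; _*_; _∸_; _≤ᵇ_; _<ᵇ_; _≤_; _<_; _⊓_; _⊔_; _<?_; _≤?_)
open import Data.Nat.Properties
open import Relation.Binary.PropositionalEquality hiding ([_])
open import Relation.Binary.Structures using (IsEquivalence)
open import Relation.Nullary using (¬_; yes; no)

module DPosetProperties {c ℓ} (X : DPoset c ℓ) where
  open DPoset X renaming (_≤_ to _⊑_; ≤-irrelevant to ⊑-irrelevant; refl to ⊑-refl; trans to ⊑-trans)
  open ≡-Reasoning

  private variable
    a a' b b' s s' t u v w x x' y y' z : Carrier

  minus-cong : (p : x ⊑ y) (p' : x' ⊑ y') → y ≡ y' → x ≡ x' →
               minus y x p ≡ minus y' x' p'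
  minus-cong p p' refl refl = cong (minus _ _) (⊑-irrelevant p p')

  minus-involutive : (p : x ⊑ y) (q : minus y x p ⊑ y) → minus y (minus y x p) q ≡ x
  minus-involutive p q = trans (minus-cong q (minus-≤ p) refl refl) (minus-invol p)

  minus-antitone : z ⊑ y → y ⊑ x → (zx : z ⊑ x) (yx : y ⊑ x) →
                   minus x y yx ⊑ minus x z zx
  minus-antitone zy yx _ _ =
    subst₂ _⊑_ (minus-cong _ _ refl refl) (minus-cong _ _ refl refl) (minus-anti zy yx)

  minus-minus : (zy : z ⊑ y) (zx : z ⊑ x) (yx : y ⊑ x) (h : minus x y yx ⊑ minus x z zx) →
                minus (minus x z zx) (minus x y yx) h ≡ minus y z zy
  minus-minus zy zx yx h =
    trans (minus-cong h (minus-anti zy yx) (minus-cong _ _ refl refl) (minus-cong _ _ refl refl))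
          (minus-assoc zy yx)

  minus-reflects-⊑ : (p : x ⊑ s) (q : y ⊑ s) → minus s y q ⊑ minus s x p → x ⊑ y
  minus-reflects-⊑ p q h =
    subst₂ _⊑_ (minus-involutive p (minus-≤ p)) (minus-involutive q (minus-≤ q))
               (minus-antitone h (minus-≤ p) (minus-≤ q) (minus-≤ p))

  minus-cancelˡ : (p : x ⊑ s) (q : y ⊑ s) → minus s x p ≡ minus s y q → x ≡ y
  minus-cancelˡ {x = x} {s = s} {y = y} p q e = begin
    x                          ≡⟨ minus-involutive p (minus-≤ p) ⟨
    minus s (minus s x p) _    ≡⟨ minus-cong (minus-≤ p) (minus-≤ q) refl e ⟩
    minus s (minus s y q) _    ≡⟨ minus-involutive q (minus-≤ q) ⟩
    y                          ∎

  infix 30 _ᶜ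
  _ᶜ : Carrier → Carrier
  x ᶜ = minus ⊤ x (⊤-max x)

  ᶜ-antitone : x ⊑ y → y ᶜ ⊑ x ᶜ
  ᶜ-antitone {x} {y} h = minus-antitone h (⊤-max y) (⊤-max x) (⊤-max y)

  ᶜ-involutive : x ᶜ ᶜ ≡ x
  ᶜ-involutive {x} = minus-involutive (⊤-max x) (⊤-max _)

  minus-ᶜ : (zx : z ⊑ x) → minus x z zx ≡ minus (z ᶜ) (x ᶜ) (ᶜ-antitone zx)
  minus-ᶜ {z} {x} zx = sym (minus-minus zx (⊤-max z) (⊤-max x) (ᶜ-antitone zx))

  minus-cancelʳ : (p : b ⊑ x) (q : b ⊑ y) → minus x b p ≡ minus y b q → x ≡ y
  minus-cancelʳ {x = x} {y = y} p q e = begin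
    x        ≡⟨ ᶜ-involutive ⟨
    x ᶜ ᶜ    ≡⟨ cong _ᶜ (minus-cancelˡ (ᶜ-antitone p) (ᶜ-antitone q)
                  (trans (sym (minus-ᶜ p)) (trans e (minus-ᶜ q)))) ⟩
    y ᶜ ᶜ    ≡⟨ ᶜ-involutive ⟩
    y        ∎

  𝟘 : Carrier
  𝟘 = ⊤ ᶜ

  𝟘-least : 𝟘 ⊑ x
  𝟘-least {x} = subst₂ _⊑_ (minus-cong _ _ refl refl) ᶜ-involutive
                           (minus-antitone (⊤-max (x ᶜ)) ⊑-refl (⊤-max (x ᶜ)) ⊑-refl)

  minus-𝟘 : (h : 𝟘 ⊑ x) → minus x 𝟘 h ≡ x
  minus-𝟘 {x} h = begin
    minus x 𝟘 h             ≡⟨ minus-ᶜ h ⟩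
    minus (𝟘 ᶜ) (x ᶜ) _     ≡⟨ minus-cong _ (⊤-max (x ᶜ)) ᶜ-involutive refl ⟩
    x ᶜ ᶜ                   ≡⟨ ᶜ-involutive ⟩
    x                       ∎

  minus-self : (h : x ⊑ x) → minus x x h ≡ 𝟘
  minus-self h = begin
    minus _ _ h                ≡⟨ minus-cong h (minus-≤ 𝟘-least) refl (sym (minus-𝟘 𝟘-least)) ⟩
    minus _ (minus _ 𝟘 _) _    ≡⟨ minus-involutive 𝟘-least (minus-≤ 𝟘-least) ⟩
    𝟘                          ∎

  IsSum-cong : a ≡ a' → b ≡ b' → s ≡ s' → IsSum a b s → IsSum a' b' s'
  IsSum-cong refl refl refl S = S

  minus-isSum : (h : x ⊑ y) → IsSum (minus y x h) x y
  minus-isSum h = h , refl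

  sum-unique : IsSum a b s → IsSum a b s' → s ≡ s'
  sum-unique (h , e) (h' , e') = minus-cancelʳ h h' (trans e (sym e'))

  sum-unique-minus : (h : y ⊑ x) (h' : y' ⊑ x') → x ≡ x' → y ≡ y' → b ≡ b' →
                     IsSum (minus x y h) b s → IsSum (minus x' y' h') b' s' → s ≡ s'
  sum-unique-minus h h' refl refl refl S S' =
    sum-unique S (IsSum-cong (minus-cong h' h refl refl) refl refl S')

  sum-cancelʳ : IsSum a b s → IsSum a' b s → a ≡ a'
  sum-cancelʳ (h , e) (h' , e') = trans (sym e) (trans (minus-cong h h' refl refl) e')

  sum-≤ˡ : IsSum a b s → a ⊑ s
  sum-≤ˡ (h , e) = subst (_⊑ _) e (minus-≤ h)

  sum-≤ʳ : IsSum a b s → b ⊑ s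
  sum-≤ʳ = proj₁

  sum-comm : IsSum a b s → IsSum b a s
  sum-comm (h , e) =
    sum-≤ˡ (h , e) , trans (minus-cong _ (minus-≤ h) refl (sym e)) (minus-involutive h (minus-≤ h))

  sum-minus-self : (h : y ⊑ y) → IsSum (minus y y h) b s → s ≡ b
  sum-minus-self {b = b} h S = sum-unique S
    (IsSum-cong (trans (minus-self ⊑-refl) (sym (minus-self h))) refl refl (minus-isSum (⊑-refl {x = b})))

  minus-telescope : (xy : x ⊑ y) (yz : y ⊑ z) (xz : x ⊑ z) →
                    IsSum (minus z y yz) (minus y x xy) (minus z x xz)
  minus-telescope {x} {y} {z} xy yz xz =
    subst (_⊑ minus z x xz) e (minus-≤ anti)
    , trans (minus-cong _ _ refl (sym e)) (minus-involutive anti (minus-≤ anti))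
    where
    anti = minus-antitone xy yz xz yz
    e = minus-minus xy xz yz anti

  minus-monoˡ : (bx : b ⊑ x) (xy : x ⊑ y) (by : b ⊑ y) → minus x b bx ⊑ minus y b by
  minus-monoˡ bx xy by = sum-≤ʳ (minus-telescope bx xy by)

  sum-assocʳ : IsSum a b u → IsSum u t v → Σ Carrier λ w → IsSum b t w × IsSum a w v
  sum-assocʳ {a} {b} {u} {t} {v} S₁@(bu , e₁) S₂@(tv , e₂) =
    minus v a av , S₃ , sum-comm (minus-isSum av)
    where
    au = sum-≤ˡ S₁
    uv = sum-≤ˡ S₂
    av = ⊑-trans au uv
    v⊖u : minus v u uv ≡ t
    v⊖u = trans (minus-cong uv (minus-≤ tv) refl (sym e₂)) (minus-involutive tv (minus-≤ tv))
    u⊖a : minus u a au ≡ b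
    u⊖a = trans (minus-cong au (minus-≤ bu) refl (sym e₁)) (minus-involutive bu (minus-≤ bu))
    t≤v⊖a : t ⊑ minus v a av
    t≤v⊖a = minus-reflects-⊑ tv (minus-≤ av)
              (subst₂ _⊑_ (sym (minus-involutive av (minus-≤ av))) (sym e₂) au)
    S₃ : IsSum b t (minus v a av)
    S₃ = t≤v⊖a , trans (minus-cong t≤v⊖a (minus-antitone au uv av uv) refl (sym v⊖u))
                       (trans (minus-minus au av uv _) u⊖a)

  sum-assocˡ : IsSum b t w → IsSum a w v → Σ Carrier λ u → IsSum a b u × IsSum u t v
  sum-assocˡ S₁ S₂ with sum-assocʳ (sum-comm S₁) (sum-comm S₂)
  ... | u , S₃ , S₄ = u , sum-comm S₃ , sum-comm S₄

  sum⇒⊑ᶜ : IsSum a b s → a ⊑ b ᶜ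
  sum⇒⊑ᶜ {b = b} (h , e) = subst (_⊑ _) e (minus-monoˡ h (⊤-max _) (⊤-max b))

  ⊑ᶜ⇒sum : a ⊑ b ᶜ → Σ Carrier (IsSum a b)
  ⊑ᶜ⇒sum {a} {b} h = d ᶜ , b≤dᶜ , e
    where
    d = minus (b ᶜ) a h
    b≤dᶜ : b ⊑ d ᶜ
    b≤dᶜ = subst (_⊑ d ᶜ) ᶜ-involutive (ᶜ-antitone (minus-≤ h))
    e : minus (d ᶜ) b b≤dᶜ ≡ a
    e = begin
      minus (d ᶜ) b b≤dᶜ          ≡⟨ minus-cong b≤dᶜ (ᶜ-antitone (minus-≤ h)) refl (sym ᶜ-involutive) ⟩
      minus (d ᶜ) (b ᶜ ᶜ) _       ≡⟨ minus-minus (minus-≤ h) (⊤-max d) (⊤-max (b ᶜ)) _ ⟩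
      minus (b ᶜ) d (minus-≤ h)   ≡⟨ minus-involutive h (minus-≤ h) ⟩
      a                           ∎

  sum-monoʳ : IsSum a b s → IsSum a b' s' → b ⊑ b' → s ⊑ s'
  sum-monoʳ S S' bb' =
    subst₂ _⊑_ (sym (sum-unique S (proj₂ (⊑ᶜ⇒sum (sum⇒⊑ᶜ S)))))
               (sym (sum-unique S' (proj₂ (⊑ᶜ⇒sum (sum⇒⊑ᶜ S')))))
               (ᶜ-antitone (minus-monoˡ (sum⇒⊑ᶜ S') (ᶜ-antitone bb') (sum⇒⊑ᶜ S)))

  sum-mono : IsSum a b s → IsSum a' b' s' → a ⊑ a' → b ⊑ b' → s ⊑ s'
  sum-mono S S' aa' bb' with ⊑ᶜ⇒sum (⊑-trans aa' (sum⇒⊑ᶜ S'))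
  ... | t , S″ = ⊑-trans (sum-monoʳ S S″ bb') (sum-monoʳ (sum-comm S″) (sum-comm S') aa')

  sum-minusʳ : (xy : x ⊑ y) (xs : x ⊑ s) → IsSum a y s → IsSum a (minus y x xy) (minus s x xs)
  sum-minusʳ xy xs (ys , e) =
    IsSum-cong e refl (minus-cong _ xs refl refl) (minus-telescope xy ys (⊑-trans xy ys))

  minus-of-sums : IsSum a b s → IsSum a' b' s' →
                  (aa : a' ⊑ a) (bb : b' ⊑ b) (ss : s' ⊑ s) →
                  IsSum (minus a a' aa) (minus b b' bb) (minus s s' ss)
  minus-of-sums S (b's' , e') aa bb ss =
    IsSum-cong refl refl (sum-cancelʳ (sum-comm S₄) S₂) S₃
    where
    b's = ⊑-trans bb (sum-≤ʳ S)
    S₁ = sum-minusʳ bb b's S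
    S₂ = IsSum-cong refl e' (minus-cong _ b's refl refl) (minus-telescope b's' ss (⊑-trans b's' ss))
    reassoc = sum-assocʳ (sum-comm (minus-isSum aa)) S₁
    S₃ = proj₁ (proj₂ reassoc)
    S₄ = proj₂ (proj₂ reassoc)

  sum-medial : ∀ {a b c d ab cd ac bd s s'} →
               IsSum a b ab → IsSum c d cd → IsSum ab cd s →
               IsSum a c ac → IsSum b d bd → IsSum ac bd s' → s ≡ s'
  sum-medial Sab Scd Ss Sac Sbd Ss' = sum-unique Ss″ Ss'
    where
    b+cd = sum-assocʳ Sab Ss
    [b+c]+d = sum-assocˡ Scd (proj₁ (proj₂ b+cd))
    c+[b+d] = sum-assocʳ (sum-comm (proj₁ (proj₂ [b+c]+d))) (proj₂ (proj₂ [b+c]+d))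
    c+bd = IsSum-cong refl (sum-unique (proj₁ (proj₂ c+[b+d])) Sbd) refl (proj₂ (proj₂ c+[b+d]))
    [a+c]+bd = sum-assocˡ c+bd (proj₂ (proj₂ b+cd))
    Ss″ = IsSum-cong (sum-unique (proj₁ (proj₂ [a+c]+bd)) Sac) refl refl (proj₂ (proj₂ [a+c]+bd))

module _ {a} {A : Set a} {x y : A} where

  if-true : ∀ {b} → T b → (if b then x else y) ≡ x
  if-true {true} _ = refl

  if-false : ∀ {b} → ¬ T b → (if b then x else y) ≡ y
  if-false {false} _ = refl
  if-false {true}  h = ⊥-elim (h _)

data Region (p e r : ℕ) : Set where
  below  : r ≤ p → Region p e r
  inside : p < r → r < e → Region p e r
  above  : e ≤ r → Region p e r

region : ∀ p e r → Region p e r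
region p e r with p <? r | r <? e
... | no r≤p   | _       = below (≮⇒≥ r≤p)
... | yes p<r  | yes r<e = inside p<r r<e
... | yes _    | no e≤r  = above (≮⇒≥ e≤r)

record PreservesRegions (p e' e : ℕ) (φ : ℕ → ℕ) : Set where
  field
    fixes-below : ∀ {r} → r ≤ p → φ r ≡ r
    maps-inside : ∀ {r} → p < r → r < e' → p < φ r × φ r < e
    maps-above  : ∀ {r} → e' ≤ r → e ≤ φ r

record IndexMap (n m : ℕ) : Set where
  field
    index    : ℕ → ℕ
    monotone : ∀ {r r'} → r ≤ r' → r' ≤ 2 * n → index r ≤ index r'
    bounded  : ∀ {r} → r ≤ 2 * n → index r ≤ 2 * m

module Faces (p q : ℕ) (p<q : p < q) where

  δ : ℕ
  δ = 2 * (q ∸ p)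

  p<p+δ : p < p + δ
  p<p+δ = m<m+n p (≤-trans (m<n⇒0<n∸m p<q) (m≤m+n (q ∸ p) _))

  2p+δ≡2q : 2 * p + δ ≡ 2 * q
  2p+δ≡2q = trans (sym (*-distribˡ-+ 2 p (q ∸ p))) (cong (2 *_) (m+[n∸m]≡n (<⇒≤ p<q)))

  +δ-bounded : ∀ {r} → r ≤ 2 * p → r + δ ≤ 2 * q
  +δ-bounded {r} h = subst (r + δ ≤_) 2p+δ≡2q (+-monoˡ-≤ δ h)

  p+δ≤2q : p + δ ≤ 2 * q
  p+δ≤2q = +δ-bounded (m≤m+n p (p + 0))

  p≤2q : p ≤ 2 * q
  p≤2q = ≤-trans (m≤m+n p δ) p+δ≤2q

  σ τ ψ : ℕ → ℕ
  σ r = if r ≤ᵇ p then r else r + δ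
  τ r = if r <ᵇ p then r else r + δ
  ψ r = (r ⊓ p) ⊔ (r ∸ δ)

  σ-below : ∀ {r} → r ≤ p → σ r ≡ r
  σ-below h = if-true (≤⇒≤ᵇ h)

  σ-above : ∀ {r} → p < r → σ r ≡ r + δ
  σ-above {r} h = if-false (<⇒≱ h ∘ ≤ᵇ⇒≤ r p)

  τ-below : ∀ {r} → r < p → τ r ≡ r
  τ-below h = if-true (<⇒<ᵇ h)

  τ-above : ∀ {r} → p ≤ r → τ r ≡ r + δ
  τ-above {r} h = if-false (≤⇒≯ h ∘ <ᵇ⇒< r p)

  record IsFace (φ : ℕ → ℕ) : Set where
    field
      fixes-below     : ∀ {r} → r < p → φ r ≡ r
      shifts-above    : ∀ {r} → p < r → φ r ≡ r + δ
      fixes-or-shifts : ∀ r → φ r ≡ r ⊎ φ r ≡ r + δ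

    ≤+δ : ∀ r → φ r ≤ r + δ
    ≤+δ r = [ (λ φr≡r → subst (_≤ r + δ) (sym φr≡r) (m≤m+n r δ)) , ≤-reflexive ]
              (fixes-or-shifts r)

  σ-isFace : IsFace σ
  σ-isFace = record
    { fixes-below     = σ-below ∘ <⇒≤
    ; shifts-above    = σ-above
    ; fixes-or-shifts = λ r → case r ≤? p of λ where
        (yes r≤p) → inj₁ (σ-below r≤p)
        (no  r>p) → inj₂ (σ-above (≰⇒> r>p))
    }

  τ-isFace : IsFace τ
  τ-isFace = record
    { fixes-below     = τ-below
    ; shifts-above    = τ-above ∘ <⇒≤
    ; fixes-or-shifts = λ r → case r <? p of λ where
        (yes r<p) → inj₁ (τ-below r<p)
        (no  r≥p) → inj₂ (τ-above (≮⇒≥ r≥p))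
    }

  σᵐ : IndexMap p q
  σᵐ = record
    { index    = σ
    ; monotone = monotone
    ; bounded  = λ {r} h → ≤-trans (IsFace.≤+δ σ-isFace r) (+δ-bounded h)
    }
    where
    monotone : ∀ {r r'} → r ≤ r' → r' ≤ 2 * p → σ r ≤ σ r'
    monotone {r} {r'} r≤r' _ with r' ≤? p
    ... | yes r'≤p = subst₂ _≤_ (sym (σ-below (≤-trans r≤r' r'≤p))) (sym (σ-below r'≤p)) r≤r'
    ... | no  r'>p = subst (σ r ≤_) (sym (σ-above (≰⇒> r'>p)))
                           (≤-trans (IsFace.≤+δ σ-isFace r) (+-monoˡ-≤ δ r≤r'))

  τᵐ : IndexMap p q
  τᵐ = record
    { index    = τ
    ; monotone = monotone
    ; bounded  = λ {r} h → ≤-trans (IsFace.≤+δ τ-isFace r) (+δ-bounded h)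
    }
    where
    monotone : ∀ {r r'} → r ≤ r' → r' ≤ 2 * p → τ r ≤ τ r'
    monotone {r} {r'} r≤r' _ with r' <? p
    ... | yes r'<p = subst₂ _≤_ (sym (τ-below (≤-<-trans r≤r' r'<p))) (sym (τ-below r'<p)) r≤r'
    ... | no  r'≥p = subst (τ r ≤_) (sym (τ-above (≮⇒≥ r'≥p)))
                           (≤-trans (IsFace.≤+δ τ-isFace r) (+-monoˡ-≤ δ r≤r'))

  ψ-below : ∀ {r} → r ≤ p → ψ r ≡ r
  ψ-below {r} h = trans (cong (_⊔ (r ∸ δ)) (m≤n⇒m⊓n≡m h)) (m≥n⇒m⊔n≡m (m∸n≤m r δ))

  ψ-middle : ∀ {r} → p ≤ r → r ≤ p + δ → ψ r ≡ p
  ψ-middle {r} h h' = trans (cong (_⊔ (r ∸ δ)) (m≥n⇒m⊓n≡n h))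
                            (m≥n⇒m⊔n≡m (m≤n+o⇒m∸n≤o r δ (subst (r ≤_) (+-comm p δ) h')))

  ψ-above : ∀ {r} → p + δ ≤ r → ψ r ≡ r ∸ δ
  ψ-above {r} h = trans (cong (_⊔ (r ∸ δ)) (m≥n⇒m⊓n≡n (≤-trans (m≤m+n p δ) h)))
                        (m≤n⇒m⊔n≡n (m+n≤o⇒m≤o∸n p h))

  ψ-mono : ∀ {r r'} → r ≤ r' → ψ r ≤ ψ r'
  ψ-mono h = ⊔-mono-≤ (⊓-mono-≤ h ≤-refl) (∸-monoˡ-≤ δ h)

  ψᵐ : IndexMap q p
  ψᵐ = record { index = ψ ; monotone = λ h _ → ψ-mono h ; bounded = bounded }
    where
    bounded : ∀ {r} → r ≤ 2 * q → ψ r ≤ 2 * p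
    bounded {r} h = ⊔-lub (≤-trans (m⊓n≤n r p) (m≤m+n p (p + 0)))
                          (m≤n+o⇒m∸n≤o r δ (subst (r ≤_) (trans (sym 2p+δ≡2q) (+-comm (2 * p) δ)) h))

  ψ-σ : ∀ r → ψ (σ r) ≡ r
  ψ-σ r with r ≤? p
  ... | yes r≤p = trans (cong ψ (σ-below r≤p)) (ψ-below r≤p)
  ... | no  r>p = trans (cong ψ (σ-above (≰⇒> r>p)))
                        (trans (ψ-above (+-monoˡ-≤ δ (<⇒≤ (≰⇒> r>p)))) (m+n∸n≡m r δ))

  ψ-τ : ∀ r → ψ (τ r) ≡ r
  ψ-τ r with r <? p
  ... | yes r<p = trans (cong ψ (τ-below r<p)) (ψ-below (<⇒≤ r<p))
  ... | no  r≥p = trans (cong ψ (τ-above (≮⇒≥ r≥p)))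
                        (trans (ψ-above (+-monoˡ-≤ δ (≮⇒≥ r≥p))) (m+n∸n≡m r δ))

  σ-ψ-below : ∀ {r} → r ≤ p → σ (ψ r) ≡ r
  σ-ψ-below h = trans (cong σ (ψ-below h)) (σ-below h)

  τ-ψ-above : ∀ {r} → p + δ ≤ r → τ (ψ r) ≡ r
  τ-ψ-above {r} h = begin
    τ (ψ r)        ≡⟨ cong τ (ψ-above h) ⟩
    τ (r ∸ δ)      ≡⟨ τ-above (m+n≤o⇒m≤o∸n p h) ⟩
    r ∸ δ + δ      ≡⟨ m∸n+n≡m (≤-trans (m≤n+m δ p) h) ⟩
    r              ∎
    where open ≡-Reasoning

module Faces³ (i j k : ℕ) (i<j : i < j) (j<k : j < k) where
  open ≡-Reasoning

  i<k : i < k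
  i<k = <-trans i<j j<k

  module ij = Faces i j i<j
  module jk = Faces j k j<k
  module ik = Faces i k i<k

  δ-sum : ik.δ ≡ ij.δ + jk.δ
  δ-sum = trans (cong (2 *_) k∸i≡) (*-distribˡ-+ 2 (j ∸ i) (k ∸ j))
    where
    k∸i≡ : k ∸ i ≡ (j ∸ i) + (k ∸ j)
    k∸i≡ = +-cancelˡ-≡ i _ _ (begin
      i + (k ∸ i)               ≡⟨ m+[n∸m]≡n (<⇒≤ i<k) ⟩
      k                         ≡⟨ m+[n∸m]≡n (<⇒≤ j<k) ⟨
      j + (k ∸ j)               ≡⟨ cong (_+ (k ∸ j)) (m+[n∸m]≡n (<⇒≤ i<j)) ⟨
      i + (j ∸ i) + (k ∸ j)     ≡⟨ +-assoc i (j ∸ i) (k ∸ j) ⟩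
      i + ((j ∸ i) + (k ∸ j))   ∎)

  +δ-sum : ∀ r → r + ij.δ + jk.δ ≡ r + ik.δ
  +δ-sum r = trans (+-assoc r ij.δ jk.δ) (cong (r +_) (sym δ-sum))

  j<+δ : ∀ {r} → i ≤ r → j < r + ij.δ
  j<+δ {r} h = ≤-trans j<i+δ (+-monoˡ-≤ ij.δ h)
    where
    j<i+δ : j < i + ij.δ
    j<i+δ = subst (_< i + ij.δ) (m+[n∸m]≡n (<⇒≤ i<j))
              (+-monoʳ-< i (m<m+n (j ∸ i) (≤-trans (m<n⇒0<n∸m i<j) (m≤m+n (j ∸ i) 0))))

  face-σ : ∀ {φ} → jk.IsFace φ → ∀ r → φ (ij.σ r) ≡ ik.σ r
  face-σ {φ} face r with r ≤? i
  ... | yes r≤i = begin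
    φ (ij.σ r)          ≡⟨ cong φ (ij.σ-below r≤i) ⟩
    φ r                 ≡⟨ jk.IsFace.fixes-below face (≤-<-trans r≤i i<j) ⟩
    r                   ≡⟨ ik.σ-below r≤i ⟨
    ik.σ r              ∎
  ... | no r≰i = begin
    φ (ij.σ r)          ≡⟨ cong φ (ij.σ-above (≰⇒> r≰i)) ⟩
    φ (r + ij.δ)        ≡⟨ jk.IsFace.shifts-above face (j<+δ (<⇒≤ (≰⇒> r≰i))) ⟩
    r + ij.δ + jk.δ     ≡⟨ +δ-sum r ⟩
    r + ik.δ            ≡⟨ ik.σ-above (≰⇒> r≰i) ⟨
    ik.σ r              ∎

  face-τ : ∀ {φ} → jk.IsFace φ → ∀ r → φ (ij.τ r) ≡ ik.τ r
  face-τ {φ} face r with r <? i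
  ... | yes r<i = begin
    φ (ij.τ r)          ≡⟨ cong φ (ij.τ-below r<i) ⟩
    φ r                 ≡⟨ jk.IsFace.fixes-below face (<-trans r<i i<j) ⟩
    r                   ≡⟨ ik.τ-below r<i ⟨
    ik.τ r              ∎
  ... | no r≮i = begin
    φ (ij.τ r)          ≡⟨ cong φ (ij.τ-above (≮⇒≥ r≮i)) ⟩
    φ (r + ij.δ)        ≡⟨ jk.IsFace.shifts-above face (j<+δ (≮⇒≥ r≮i)) ⟩
    r + ij.δ + jk.δ     ≡⟨ +δ-sum r ⟩
    r + ik.δ            ≡⟨ ik.τ-above (≮⇒≥ r≮i) ⟨
    ik.τ r              ∎

  e-split : i + ik.δ ≡ i + ij.δ + jk.δ
  e-split = sym (+δ-sum i)

  j+δ<e : j + jk.δ < i + ik.δ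
  j+δ<e = subst (j + jk.δ <_) (sym e-split) (+-monoˡ-< jk.δ (j<+δ ≤-refl))

  ∸δ-≥ : ∀ {r} → i + ik.δ ≤ r → i + ij.δ ≤ r ∸ jk.δ
  ∸δ-≥ {r} h = m+n≤o⇒m≤o∸n (i + ij.δ) (subst (_≤ r) e-split h)

  ψ-at-e : jk.ψ (i + ik.δ) ≡ i + ij.δ
  ψ-at-e = trans (jk.ψ-above (<⇒≤ j+δ<e))
                 (trans (cong (_∸ jk.δ) e-split) (m+n∸n≡m (i + ij.δ) jk.δ))

  ψ-ψ : ∀ r → ij.ψ (jk.ψ r) ≡ ik.ψ r
  ψ-ψ r with r ≤? i | r ≤? i + ik.δ
  ... | yes r≤i | _ = begin
    ij.ψ (jk.ψ r)       ≡⟨ cong ij.ψ (jk.ψ-below (≤-trans r≤i (<⇒≤ i<j))) ⟩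
    ij.ψ r              ≡⟨ ij.ψ-below r≤i ⟩
    r                   ≡⟨ ik.ψ-below r≤i ⟨
    ik.ψ r              ∎
  ... | no r≰i | yes r≤e = trans (ij.ψ-middle lower upper) (sym (ik.ψ-middle (<⇒≤ (≰⇒> r≰i)) r≤e))
    where
    lower : i ≤ jk.ψ r
    lower = subst (_≤ jk.ψ r) (jk.ψ-below (<⇒≤ i<j)) (jk.ψ-mono (<⇒≤ (≰⇒> r≰i)))
    upper : jk.ψ r ≤ i + ij.δ
    upper = subst (jk.ψ r ≤_) ψ-at-e (jk.ψ-mono r≤e)
  ... | no _ | no r≰e = begin
    ij.ψ (jk.ψ r)       ≡⟨ cong ij.ψ (jk.ψ-above (≤-trans (<⇒≤ j+δ<e) e≤r)) ⟩
    ij.ψ (r ∸ jk.δ)     ≡⟨ ij.ψ-above (∸δ-≥ e≤r) ⟩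
    r ∸ jk.δ ∸ ij.δ     ≡⟨ ∸-+-assoc r jk.δ ij.δ ⟩
    r ∸ (jk.δ + ij.δ)   ≡⟨ cong (r ∸_) (trans (+-comm jk.δ ij.δ) (sym δ-sum)) ⟩
    r ∸ ik.δ            ≡⟨ ik.ψ-above e≤r ⟨
    ik.ψ r              ∎
    where
    e≤r = <⇒≤ (≰⇒> r≰e)

  face-preservesRegions : ∀ {φ} → jk.IsFace φ → PreservesRegions i (i + ij.δ) (i + ik.δ) φ
  face-preservesRegions {φ} face = record
    { fixes-below = λ r≤i → fixes-below (≤-<-trans r≤i i<j)
    ; maps-inside = maps-inside
    ; maps-above  = λ {r} e≤r → subst (_≤ φ r) (sym e-split)
        (subst (_ ≤_) (sym (shifts-above (<-≤-trans (j<+δ ≤-refl) e≤r))) (+-monoˡ-≤ jk.δ e≤r))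
    }
    where
    open jk.IsFace face
    maps-inside : ∀ {r} → i < r → r < i + ij.δ → i < φ r × φ r < i + ik.δ
    maps-inside {r} i<r r<e with fixes-or-shifts r
    ... | inj₁ φr≡r = subst (i <_) (sym φr≡r) i<r
                    , subst₂ _<_ (sym φr≡r) (sym e-split) (<-≤-trans r<e (m≤m+n _ jk.δ))
    ... | inj₂ φr≡r+δ = subst (i <_) (sym φr≡r+δ) (<-≤-trans i<r (m≤m+n r jk.δ))
                      , subst₂ _<_ (sym φr≡r+δ) (sym e-split) (+-monoˡ-< jk.δ r<e)

  ψ-preservesRegions : PreservesRegions i (i + ik.δ) (i + ij.δ) jk.ψ
  ψ-preservesRegions = record
    { fixes-below = λ r≤i → jk.ψ-below (≤-trans r≤i (<⇒≤ i<j))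
    ; maps-inside = maps-inside
    ; maps-above  = λ e≤r →
        subst (_ ≤_) (sym (jk.ψ-above (≤-trans (<⇒≤ j+δ<e) e≤r))) (∸δ-≥ e≤r)
    }
    where
    maps-inside : ∀ {r} → i < r → r < i + ik.δ → i < jk.ψ r × jk.ψ r < i + ij.δ
    maps-inside {r} i<r r<e = lower , upper
      where
      lower : i < jk.ψ r
      lower = subst (_≤ jk.ψ r) (jk.ψ-below i<j) (jk.ψ-mono i<r)
      upper : jk.ψ r < i + ij.δ
      upper with r ≤? j + jk.δ
      ... | yes r≤j+δ = ≤-<-trans (subst (jk.ψ r ≤_) (jk.ψ-middle (m≤m+n j jk.δ) ≤-refl)
                                         (jk.ψ-mono r≤j+δ))
                                  (j<+δ ≤-refl)
      ... | no  r≰j+δ = subst (_< i + ij.δ) (sym (jk.ψ-above (<⇒≤ (≰⇒> r≰j+δ))))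
                          (subst (r ∸ jk.δ <_) (m+n∸n≡m (i + ij.δ) jk.δ)
                            (∸-monoˡ-< (subst (r <_) e-split r<e)
                                       (≤-trans (m≤n+m jk.δ j) (<⇒≤ (≰⇒> r≰j+δ)))))

module CellProperties {c ℓ} (X : DPoset c ℓ) where
  open Cells X
  open IndexMap

  ≈-isEquivalence : ∀ m → IsEquivalence {A = Cell m} (_≈[ m ]_)
  ≈-isEquivalence m = record
    { refl  = λ _ _ → refl
    ; sym   = λ f≈g r r≤2m → sym (f≈g r r≤2m)
    ; trans = λ f≈g g≈h r r≤2m → trans (f≈g r r≤2m) (g≈h r r≤2m)
    }

  reindex : ∀ {m n} → IndexMap n m → Cell m → Cell n
  reindex φ f = cell (fun f ∘ index φ) λ r≤r' r'≤2n →
    mono f (monotone φ r≤r' r'≤2n) (bounded φ r'≤2n)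

  reindex-cong : ∀ {m n} (φ : IndexMap n m) {f g} → f ≈[ m ] g → reindex φ f ≈[ n ] reindex φ g
  reindex-cong φ f≈g r r≤2n = f≈g (index φ r) (bounded φ r≤2n)

module CellCategory {c ℓ} (X : DPoset c ℓ) (p q : ℕ) (p<q : p < q) where
  open DPoset X renaming (_≤_ to _⊑_; refl to ⊑-refl; trans to ⊑-trans)
  open DPosetProperties X
  open Cells X
  open CellProperties X
  open Faces p q p<q public
  open ≡-Reasoning

  src tgt : Cell q → Cell p
  src = reindex σᵐ
  tgt = reindex τᵐ

  id : Cell p → Cell q
  id = reindex ψᵐ

  IdRaw-ψ : ∀ (a : ℕ → Carrier) r → IdRaw p q a r ≡ a (ψ r)
  IdRaw-ψ a r with r <? p | r ≤? p + δ
  ... | yes r<p | _ = trans (if-true (<⇒<ᵇ r<p)) (cong a (sym (ψ-below (<⇒≤ r<p))))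
  ... | no r≮p | yes r≤e = trans (if-false (r≮p ∘ <ᵇ⇒< r p))
                                 (trans (if-true (≤⇒≤ᵇ r≤e)) (cong a (sym (ψ-middle (≮⇒≥ r≮p) r≤e))))
  ... | no r≮p | no r≰e = trans (if-false (r≮p ∘ <ᵇ⇒< r p))
                                (trans (if-false (r≰e ∘ ≤ᵇ⇒≤ r (p + δ)))
                                       (cong a (sym (ψ-above (<⇒≤ (≰⇒> r≰e))))))

  src-id : ∀ a → src (id a) ≈[ p ] a
  src-id a r _ = cong (fun a) (ψ-σ r)

  tgt-id : ∀ a → tgt (id a) ≈[ p ] a
  tgt-id a r _ = cong (fun a) (ψ-τ r)

  Composable : Cell q → Cell q → Set c
  Composable f g = src f ≈[ p ] tgt g

  p≤2p : p ≤ 2 * p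
  p≤2p = m≤m+n p (p + 0)

  module _ (f g : Cell q) (fg : Composable f g) where

    composable-below : ∀ {r} → r < p → fun f r ≡ fun g r
    composable-below {r} r<p = begin
      fun f r       ≡⟨ cong (fun f) (σ-below (<⇒≤ r<p)) ⟨
      fun f (σ r)   ≡⟨ fg r (≤-trans (<⇒≤ r<p) p≤2p) ⟩
      fun g (τ r)   ≡⟨ cong (fun g) (τ-below r<p) ⟩
      fun g r       ∎

    composable-at : fun f p ≡ fun g (p + δ)
    composable-at = begin
      fun f p       ≡⟨ cong (fun f) (σ-below ≤-refl) ⟨
      fun f (σ p)   ≡⟨ fg p p≤2p ⟩
      fun g (τ p)   ≡⟨ cong (fun g) (τ-above ≤-refl) ⟩
      fun g (p + δ) ∎

    composable-above : ∀ {r} → p < r → r ≤ 2 * p → fun f (r + δ) ≡ fun g (r + δ)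
    composable-above {r} p<r r≤2p = begin
      fun f (r + δ) ≡⟨ cong (fun f) (σ-above p<r) ⟨
      fun f (σ r)   ≡⟨ fg r r≤2p ⟩
      fun g (τ r)   ≡⟨ cong (fun g) (τ-above (<⇒≤ p<r)) ⟩
      fun g (r + δ) ∎

  value-⊑ : ∀ (f : Cell q) {r} → p < r → r < p + δ → fun f p ⊑ fun f r
  value-⊑ f p<r r<e = mono f (<⇒≤ p<r) (≤-trans (<⇒≤ r<e) p+δ≤2q)

  module Composite (f g : Cell q) (fg : Composable f g) where

    g⊑fp : ∀ {r} → r ≤ p + δ → fun g r ⊑ fun f p
    g⊑fp r≤e = subst (_ ⊑_) (sym (composable-at f g fg)) (mono g r≤e p+δ≤2q)

    difference-⊑ᶜ : ∀ {r} (p<r : p < r) (r<e : r < p + δ) →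
                    minus (fun f r) (fun f p) (value-⊑ f p<r r<e) ⊑ fun g r ᶜ
    difference-⊑ᶜ p<r r<e =
      ⊑-trans (minus-monoˡ _ (⊤-max _) (⊤-max _)) (ᶜ-antitone (g⊑fp (<⇒≤ r<e)))

    value : ℕ → Carrier
    value r with region p (p + δ) r
    ... | below _          = fun g r
    ... | inside p<r r<e   = proj₁ (⊑ᶜ⇒sum (difference-⊑ᶜ p<r r<e))
    ... | above _          = fun f r

    value-below : ∀ {r} → r ≤ p → value r ≡ fun g r
    value-below {r} r≤p with region p (p + δ) r
    ... | below _      = refl
    ... | inside p<r _ = ⊥-elim (<⇒≱ p<r r≤p)
    ... | above e≤r    = ⊥-elim (<⇒≱ (≤-<-trans r≤p p<p+δ) e≤r)

    value-inside : ∀ {r} → p < r → r < p + δ → (h : fun f p ⊑ fun f r) →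
                   IsSum (minus (fun f r) (fun f p) h) (fun g r) (value r)
    value-inside {r} p<r' r<e' h with region p (p + δ) r
    ... | below r≤p      = ⊥-elim (<⇒≱ p<r' r≤p)
    ... | inside p<r r<e = IsSum-cong (minus-cong _ h refl refl) refl refl
                                      (proj₂ (⊑ᶜ⇒sum (difference-⊑ᶜ p<r r<e)))
    ... | above e≤r      = ⊥-elim (<⇒≱ r<e' e≤r)

    value-above : ∀ {r} → p + δ ≤ r → value r ≡ fun f r
    value-above {r} e≤r with region p (p + δ) r
    ... | below r≤p    = ⊥-elim (<⇒≱ (≤-<-trans r≤p p<p+δ) e≤r)
    ... | inside _ r<e = ⊥-elim (<⇒≱ r<e e≤r)
    ... | above _      = refl

    value-inside′ : ∀ {r} (p<r : p < r) (r<e : r < p + δ) →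
                    IsSum (minus (fun f r) (fun f p) (value-⊑ f p<r r<e)) (fun g r) (value r)
    value-inside′ p<r r<e = value-inside p<r r<e (value-⊑ f p<r r<e)

    value-mono : ∀ {r r'} → r ≤ r' → r' ≤ 2 * q → value r ⊑ value r'
    value-mono {r} {r'} r≤r' r'≤2q = go (region p (p + δ) r) (region p (p + δ) r')
      where
      go : Region p (p + δ) r → Region p (p + δ) r' → value r ⊑ value r'
      go (below a) (below b) =
        subst₂ _⊑_ (sym (value-below a)) (sym (value-below b)) (mono g r≤r' r'≤2q)
      go (below a) (inside b b') =
        subst (_⊑ _) (sym (value-below a)) (⊑-trans (mono g r≤r' r'≤2q) (sum-≤ʳ (value-inside′ b b')))
      go (below a) (above b) = subst₂ _⊑_ (sym (value-below a)) (sym (value-above b))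
        (⊑-trans (g⊑fp (≤-trans a (<⇒≤ p<p+δ))) (mono f (≤-trans (<⇒≤ p<p+δ) b) r'≤2q))
      go (inside a _) (below b) = ⊥-elim (<⇒≱ a (≤-trans r≤r' b))
      go (inside a a') (inside b b') =
        sum-mono (value-inside′ a a') (value-inside′ b b')
                 (minus-monoˡ _ (mono f r≤r' r'≤2q) _) (mono g r≤r' r'≤2q)
      go (inside a a') (above b) = subst (_ ⊑_) (sym (value-above b))
        (⊑-trans (sum-monoʳ (value-inside′ a a') (minus-isSum (value-⊑ f a a')) (g⊑fp (<⇒≤ a')))
                 (mono f r≤r' r'≤2q))
      go (above a) (below b) = ⊥-elim (<⇒≱ (≤-<-trans (≤-trans r≤r' b) p<p+δ) a)
      go (above a) (inside _ b') = ⊥-elim (<⇒≱ b' (≤-trans a r≤r'))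
      go (above a) (above b) =
        subst₂ _⊑_ (sym (value-above a)) (sym (value-above b)) (mono f r≤r' r'≤2q)

  comp : (f g : Cell q) → Composable f g → Cell q
  comp f g fg = cell value value-mono
    where open Composite f g fg

  module _ (f g : Cell q) (fg : Composable f g) where
    open Composite f g fg

    comp-below : ∀ {r} → r ≤ p → fun (comp f g fg) r ≡ fun g r
    comp-below = value-below

    comp-inside : ∀ {r} → p < r → r < p + δ → (h : fun f p ⊑ fun f r) →
                  IsSum (minus (fun f r) (fun f p) h) (fun g r) (fun (comp f g fg) r)
    comp-inside = value-inside

    comp-above : ∀ {r} → p + δ ≤ r → fun (comp f g fg) r ≡ fun f r
    comp-above = value-above

    comp-spec : ∀ r → CompSpec p q (fun f) (fun g) (fun (comp f g fg)) r
    comp-spec r = comp-below , (λ p<r r<e → _ , value-inside′ p<r r<e) , comp-above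

  src-cong : ∀ {f g} → f ≈[ q ] g → src f ≈[ p ] src g
  src-cong {f} {g} = reindex-cong σᵐ {f} {g}

  tgt-cong : ∀ {f g} → f ≈[ q ] g → tgt f ≈[ p ] tgt g
  tgt-cong {f} {g} = reindex-cong τᵐ {f} {g}

  id-cong : ∀ {a b} → a ≈[ p ] b → id a ≈[ q ] id b
  id-cong {a} {b} = reindex-cong ψᵐ {a} {b}

  comp-cong : ∀ {f f' g g'} fg f'g' → f ≈[ q ] f' → g ≈[ q ] g' →
              comp f g fg ≈[ q ] comp f' g' f'g'
  comp-cong {f} {f'} {g} {g'} fg f'g' f≈f' g≈g' r r≤2q = case region p (p + δ) r of λ where
    (below r≤p) → trans (comp-below f g fg r≤p)
                        (trans (g≈g' r r≤2q) (sym (comp-below f' g' f'g' r≤p)))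
    (above e≤r) → trans (comp-above f g fg e≤r)
                        (trans (f≈f' r r≤2q) (sym (comp-above f' g' f'g' e≤r)))
    (inside p<r r<e) → sum-unique-minus (value-⊑ f p<r r<e) (value-⊑ f' p<r r<e)
      (f≈f' r r≤2q) (f≈f' p p≤2q) (g≈g' r r≤2q)
      (comp-inside f g fg p<r r<e _) (comp-inside f' g' f'g' p<r r<e _)

  src-comp : ∀ f g fg → src (comp f g fg) ≈[ p ] src g
  src-comp f g fg r r≤2p with r ≤? p
  ... | yes r≤p = comp-below f g fg (subst (_≤ p) (sym (σ-below r≤p)) r≤p)
  ... | no  r≰p = begin
    fun (comp f g fg) (σ r)   ≡⟨ comp-above f g fg e≤σr ⟩
    fun f (σ r)               ≡⟨ cong (fun f) (σ-above p<r) ⟩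
    fun f (r + δ)             ≡⟨ composable-above f g fg p<r r≤2p ⟩
    fun g (r + δ)             ≡⟨ cong (fun g) (σ-above p<r) ⟨
    fun g (σ r)               ∎
    where
    p<r = ≰⇒> r≰p
    e≤σr = subst (p + δ ≤_) (sym (σ-above p<r)) (+-monoˡ-≤ δ (<⇒≤ p<r))

  tgt-comp : ∀ f g fg → tgt (comp f g fg) ≈[ p ] tgt f
  tgt-comp f g fg r r≤2p with r <? p
  ... | yes r<p = begin
    fun (comp f g fg) (τ r)   ≡⟨ cong (fun (comp f g fg)) (τ-below r<p) ⟩
    fun (comp f g fg) r       ≡⟨ comp-below f g fg (<⇒≤ r<p) ⟩
    fun g r                   ≡⟨ composable-below f g fg r<p ⟨
    fun f r                   ≡⟨ cong (fun f) (τ-below r<p) ⟨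
    fun f (τ r)               ∎
  ... | no  r≮p = comp-above f g fg (subst (p + δ ≤_) (sym (τ-above p≤r)) (+-monoˡ-≤ δ p≤r))
    where p≤r = ≮⇒≥ r≮p

  comp-assoc : ∀ f g h fg [fg]h gh f[gh] →
               comp (comp f g fg) h [fg]h ≈[ q ] comp f (comp g h gh) f[gh]
  comp-assoc f g h fg [fg]h gh f[gh] r r≤2q = case region p (p + δ) r of λ where
      (below r≤p) → trans (comp-below fg∘ h [fg]h r≤p)
                          (sym (trans (comp-below f gh∘ f[gh] r≤p) (comp-below g h gh r≤p)))
      (above e≤r) → trans (comp-above fg∘ h [fg]h e≤r)
                          (trans (comp-above f g fg e≤r) (sym (comp-above f gh∘ f[gh] e≤r)))
      (inside p<r r<e) → middle p<r r<e
    where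
    fg∘ = comp f g fg
    gh∘ = comp g h gh
    -- Both sides are (f r ⊖ f p) ⊕ (g r ⊖ g p) ⊕ h r, bracketed differently.
    middle : ∀ {r} → p < r → r < p + δ → fun (comp fg∘ h [fg]h) r ≡ fun (comp f gh∘ f[gh]) r
    middle {r} p<r r<e = sum-unique S₄ (comp-inside f gh∘ f[gh] p<r r<e _)
      where
      Sfg = comp-inside f g fg p<r r<e (value-⊑ f p<r r<e)
      gp⊑gr = value-⊑ g p<r r<e
      gp⊑fgr = ⊑-trans gp⊑gr (sum-≤ʳ Sfg)
      S₁ = sum-minusʳ gp⊑gr gp⊑fgr Sfg
      S₂ : IsSum (minus (fun fg∘ r) (fun g p) gp⊑fgr) (fun h r) (fun (comp fg∘ h [fg]h) r)
      S₂ = IsSum-cong (minus-cong _ _ refl (comp-below f g fg ≤-refl)) refl refl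
                      (comp-inside fg∘ h [fg]h p<r r<e (value-⊑ fg∘ p<r r<e))
      S₃ = sum-assocʳ S₁ S₂
      S₄ = IsSum-cong refl (sum-unique (proj₁ (proj₂ S₃)) (comp-inside g h gh p<r r<e _)) refl
                      (proj₂ (proj₂ S₃))

  comp-idˡ : ∀ f fg → comp (id (tgt f)) f fg ≈[ q ] f
  comp-idˡ f fg r r≤2q = case region p (p + δ) r of λ where
      (below r≤p) → comp-below ι f fg r≤p
      (inside p<r r<e) → sum-minus-self ⊑-refl
        (IsSum-cong (minus-cong _ _ (ι-constant p<r r<e) refl) refl refl
                    (comp-inside ι f fg p<r r<e (value-⊑ ι p<r r<e)))
      (above e≤r) → trans (comp-above ι f fg e≤r) (cong (fun f) (τ-ψ-above e≤r))
    where
    ι = id (tgt f)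
    ι-constant : ∀ {r} → p < r → r < p + δ → fun ι r ≡ fun ι p
    ι-constant p<r r<e =
      cong (fun f ∘ τ) (trans (ψ-middle (<⇒≤ p<r) (<⇒≤ r<e)) (sym (ψ-below ≤-refl)))

  comp-idʳ : ∀ f fg → comp f (id (src f)) fg ≈[ q ] f
  comp-idʳ f fg r r≤2q = case region p (p + δ) r of λ where
      (below r≤p) → trans (comp-below f ι fg r≤p) (cong (fun f) (σ-ψ-below r≤p))
      (inside p<r r<e) → sum-unique
        (IsSum-cong refl (ι-constant p<r r<e) refl (comp-inside f ι fg p<r r<e (value-⊑ f p<r r<e)))
        (minus-isSum (value-⊑ f p<r r<e))
      (above e≤r) → comp-above f ι fg e≤r
    where
    ι = id (src f)
    ι-constant : ∀ {r} → p < r → r < p + δ → fun ι r ≡ fun f p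
    ι-constant p<r r<e = cong (fun f) (trans (cong σ (ψ-middle (<⇒≤ p<r) (<⇒≤ r<e))) (σ-below ≤-refl))

module CompReindex {c ℓ} (X : DPoset c ℓ) (p q q' : ℕ) (p<q : p < q) (p<q' : p < q') where
  open DPosetProperties X
  open Cells X
  open ≡-Reasoning
  module Q  = CellCategory X p q p<q
  module Q′ = CellCategory X p q' p<q'

  comp-reindex : ∀ {φ} → PreservesRegions p (p + Q′.δ) (p + Q.δ) φ →
    ∀ f g fg f' g' f'g' →
    (∀ r → r ≤ 2 * q' → fun f' r ≡ fun f (φ r)) →
    (∀ r → r ≤ 2 * q' → fun g' r ≡ fun g (φ r)) →
    ∀ r → r ≤ 2 * q' → fun (Q′.comp f' g' f'g') r ≡ fun (Q.comp f g fg) (φ r)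
  comp-reindex {φ} φ-regions f g fg f' g' f'g' f'≡f∘φ g'≡g∘φ r r≤2q' =
    case region p (p + Q′.δ) r of λ where
      (below r≤p) → begin
        fun (Q′.comp f' g' f'g') r   ≡⟨ Q′.comp-below f' g' f'g' r≤p ⟩
        fun g' r                     ≡⟨ g'≡g∘φ r r≤2q' ⟩
        fun g (φ r)                  ≡⟨ Q.comp-below f g fg (subst (_≤ p) (sym (fixes-below r≤p)) r≤p) ⟨
        fun (Q.comp f g fg) (φ r)    ∎
      (inside p<r r<e) →
        let p<φr = proj₁ (maps-inside p<r r<e)
            φr<e = proj₂ (maps-inside p<r r<e)
        in sum-unique-minus (Q′.value-⊑ f' p<r r<e) (Q.value-⊑ f p<φr φr<e)
             (f'≡f∘φ r r≤2q') (trans (f'≡f∘φ p Q′.p≤2q) (cong (fun f) (fixes-below ≤-refl)))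
             (g'≡g∘φ r r≤2q')
             (Q′.comp-inside f' g' f'g' p<r r<e _) (Q.comp-inside f g fg p<φr φr<e _)
      (above e≤r) → trans (Q′.comp-above f' g' f'g' e≤r)
                          (trans (f'≡f∘φ r r≤2q') (sym (Q.comp-above f g fg (maps-above e≤r))))
    where open PreservesRegions φ-regions

module StrictTwoCategory {c ℓ} (X : DPoset c ℓ) (i j k : ℕ) (i<j : i < j) (j<k : j < k) where
  open DPoset X renaming (_≤_ to _⊑_; refl to ⊑-refl; trans to ⊑-trans)
  open DPosetProperties X
  open Cells X
  open CellProperties X using (≈-isEquivalence)
  open Faces³ i j k i<j j<k
  open ≡-Reasoning
  module IJ = CellCategory X i j i<j
  module JK = CellCategory X j k j<k
  module IK = CellCategory X i k i<k

  HComposable : Cell k → Cell k → Set c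
  HComposable α β = IJ.src (JK.src α) ≈[ i ] IJ.tgt (JK.src β)

  hComposable⇒composable : ∀ α β → HComposable α β → IK.Composable α β
  hComposable⇒composable α β αβ r r≤2i = begin
    fun α (ik.σ r)               ≡⟨ cong (fun α) (face-σ jk.σ-isFace r) ⟨
    fun α (jk.σ (ij.σ r))        ≡⟨ αβ r r≤2i ⟩
    fun β (jk.σ (ij.τ r))        ≡⟨ cong (fun β) (face-τ jk.σ-isFace r) ⟩
    fun β (ik.τ r)               ∎

  hcomp : (α β : Cell k) → HComposable α β → Cell k
  hcomp α β αβ = IK.comp α β (hComposable⇒composable α β αβ)

  hcomp-cong : ∀ {α α' β β'} αβ α'β' → α ≈[ k ] α' → β ≈[ k ] β' →
               hcomp α β αβ ≈[ k ] hcomp α' β' α'β'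
  hcomp-cong {α} {α'} {β} {β'} αβ α'β' =
    IK.comp-cong (hComposable⇒composable α β αβ) (hComposable⇒composable α' β' α'β')

  glob-src : ∀ α → IJ.src (JK.src α) ≈[ i ] IJ.src (JK.tgt α)
  glob-src α r _ = cong (fun α) (trans (face-σ jk.σ-isFace r) (sym (face-σ jk.τ-isFace r)))

  glob-tgt : ∀ α → IJ.tgt (JK.src α) ≈[ i ] IJ.tgt (JK.tgt α)
  glob-tgt α r _ = cong (fun α) (trans (face-τ jk.σ-isFace r) (sym (face-τ jk.τ-isFace r)))

  module IKfromIJ = CompReindex X i k j i<k i<j
  module IJfromIK = CompReindex X i j k i<j i<k

  src-hcomp : ∀ α β αβ sαsβ → JK.src (hcomp α β αβ) ≈[ j ] IJ.comp (JK.src α) (JK.src β) sαsβ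
  src-hcomp α β αβ sαsβ r r≤2j = sym (IKfromIJ.comp-reindex (face-preservesRegions jk.σ-isFace)
    α β (hComposable⇒composable α β αβ) (JK.src α) (JK.src β) sαsβ
    (λ _ _ → refl) (λ _ _ → refl) r r≤2j)

  tgt-hcomp : ∀ α β αβ tαtβ → JK.tgt (hcomp α β αβ) ≈[ j ] IJ.comp (JK.tgt α) (JK.tgt β) tαtβ
  tgt-hcomp α β αβ tαtβ r r≤2j = sym (IKfromIJ.comp-reindex (face-preservesRegions jk.τ-isFace)
    α β (hComposable⇒composable α β αβ) (JK.tgt α) (JK.tgt β) tαtβ
    (λ _ _ → refl) (λ _ _ → refl) r r≤2j)

  hcomp-id : ∀ f g IfIg fg → hcomp (JK.id f) (JK.id g) IfIg ≈[ k ] JK.id (IJ.comp f g fg)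
  hcomp-id f g IfIg fg = IJfromIK.comp-reindex ψ-preservesRegions f g fg (JK.id f) (JK.id g)
    (hComposable⇒composable (JK.id f) (JK.id g) IfIg) (λ _ _ → refl) (λ _ _ → refl)

  hcomp-idˡ : ∀ α αβ → hcomp (JK.id (IJ.id (IJ.tgt (JK.src α)))) α αβ ≈[ k ] α
  hcomp-idˡ α αβ r r≤2k =
    trans (IK.comp-cong _ ια ι′≈ι (λ _ _ → refl) r r≤2k) (IK.comp-idˡ α ια r r≤2k)
    where
    ι = IK.id (IK.tgt α)
    ια = IK.src-id (IK.tgt α)
    ι′≈ι : JK.id (IJ.id (IJ.tgt (JK.src α))) ≈[ k ] ι
    ι′≈ι r _ = cong (fun α) (trans (face-τ jk.σ-isFace (ij.ψ (jk.ψ r))) (cong ik.τ (ψ-ψ r)))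

  hcomp-idʳ : ∀ α αβ → hcomp α (JK.id (IJ.id (IJ.src (JK.src α)))) αβ ≈[ k ] α
  hcomp-idʳ α αβ r r≤2k =
    trans (IK.comp-cong _ αι (λ _ _ → refl) ι′≈ι r r≤2k) (IK.comp-idʳ α αι r r≤2k)
    where
    ι = IK.id (IK.src α)
    αι : IK.Composable α ι
    αι r r≤2i = sym (IK.tgt-id (IK.src α) r r≤2i)
    ι′≈ι : JK.id (IJ.id (IJ.src (JK.src α))) ≈[ k ] ι
    ι′≈ι r _ = cong (fun α) (trans (face-σ jk.σ-isFace (ij.ψ (jk.ψ r))) (cong ik.σ (ψ-ψ r)))

  module Interchange (α α' β β' : Cell k) (u : JK.Composable α α') (v : JK.Composable β β')
                     (w : HComposable (JK.comp α α' u) (JK.comp β β' v))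
                     (x : HComposable α β) (y : HComposable α' β')
                     (z : JK.Composable (hcomp α β x) (hcomp α' β' y)) where
    A B H H' : Cell k
    A = JK.comp α α' u
    B = JK.comp β β' v
    H = hcomp α β x
    H' = hcomp α' β' y

    AB = hComposable⇒composable A B w
    αβ = hComposable⇒composable α β x
    α'β' = hComposable⇒composable α' β' y

    A-at-i : fun A i ≡ fun α' i
    A-at-i = JK.comp-below α α' u (<⇒≤ i<j)

    -- Inside both the (i,k)- and the (j,k)-composition region, both sides are
    -- (α r ⊖ α j) ⊕ (α' r ⊖ α' i) ⊕ (β r ⊖ β j) ⊕ β' r, bracketed differently.
    inside-both : ∀ {r} → j < r → r < j + jk.δ →
                  fun (IK.comp A B AB) r ≡ fun (JK.comp H H' z) r
    inside-both {r} j<r r<e = sum-medial U SB SX V SH' SY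
      where
      i<r = <-trans i<j j<r
      r<e' = <-trans r<e j+δ<e
      j<e' = <-trans j<r r<e'
      αi⊑αj = mono α (<⇒≤ i<j) JK.p≤2q
      αj⊑αr = JK.value-⊑ α j<r r<e
      α'i⊑α'r = IK.value-⊑ α' i<r r<e'
      βj⊑βr = JK.value-⊑ β j<r r<e
      Hj⊑Hr = JK.value-⊑ H j<r r<e
      telescope = minus-telescope αi⊑αj αj⊑αr (⊑-trans αi⊑αj αj⊑αr)
      SA = JK.comp-inside α α' u j<r r<e αj⊑αr
      α'i⊑Ar = ⊑-trans α'i⊑α'r (sum-≤ʳ SA)
      U = sum-minusʳ α'i⊑α'r α'i⊑Ar SA
      SB = JK.comp-inside β β' v j<r r<e βj⊑βr
      SX = IsSum-cong (minus-cong _ α'i⊑Ar refl A-at-i) refl refl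
                      (IK.comp-inside A B AB i<r r<e' (IK.value-⊑ A i<r r<e'))
      SH = IK.comp-inside α β αβ i<r r<e' (⊑-trans αi⊑αj αj⊑αr)
      SHj = IK.comp-inside α β αβ i<j j<e' αi⊑αj
      V = IsSum-cong (proj₂ telescope) refl refl (minus-of-sums SH SHj (proj₁ telescope) βj⊑βr Hj⊑Hr)
      SH' = IK.comp-inside α' β' α'β' i<r r<e' α'i⊑α'r
      SY = JK.comp-inside H H' z j<r r<e Hj⊑Hr

    middle : ∀ {r} → i < r → r < i + ik.δ → fun (IK.comp A B AB) r ≡ fun (JK.comp H H' z) r
    middle {r} i<r r<e = case region j (j + jk.δ) r of λ where
        (below r≤j) → sum-unique-minus (IK.value-⊑ A i<r r<e) (IK.value-⊑ α' i<r r<e)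
          (JK.comp-below α α' u r≤j) A-at-i (JK.comp-below β β' v r≤j)
          (IK.comp-inside A B AB i<r r<e _)
          (subst (IsSum _ _) (sym (JK.comp-below H H' z r≤j)) (IK.comp-inside α' β' α'β' i<r r<e _))
        (inside j<r r<e″) → inside-both j<r r<e″
        (above e≤r) → sum-unique-minus (IK.value-⊑ A i<r r<e) (IK.value-⊑ α i<r r<e)
          (JK.comp-above α α' u e≤r) (trans A-at-i (sym (JK.composable-below α α' u i<j)))
          (JK.comp-above β β' v e≤r)
          (IK.comp-inside A B AB i<r r<e _)
          (subst (IsSum _ _) (sym (JK.comp-above H H' z e≤r)) (IK.comp-inside α β αβ i<r r<e _))

    below-j : ∀ {r} → r ≤ i → r ≤ j
    below-j r≤i = ≤-trans r≤i (<⇒≤ i<j)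

    above-j : ∀ {r} → i + ik.δ ≤ r → j + jk.δ ≤ r
    above-j e≤r = ≤-trans (<⇒≤ j+δ<e) e≤r

    interchange : hcomp A B w ≈[ k ] JK.comp H H' z
    interchange r r≤2k = case region i (i + ik.δ) r of λ where
        (below r≤i) → begin
          fun (IK.comp A B AB) r   ≡⟨ IK.comp-below A B AB r≤i ⟩
          fun B r                  ≡⟨ JK.comp-below β β' v (below-j r≤i) ⟩
          fun β' r                 ≡⟨ IK.comp-below α' β' α'β' r≤i ⟨
          fun H' r                 ≡⟨ JK.comp-below H H' z (below-j r≤i) ⟨
          fun (JK.comp H H' z) r   ∎
        (inside i<r r<e) → middle i<r r<e
        (above e≤r) → begin
          fun (IK.comp A B AB) r   ≡⟨ IK.comp-above A B AB e≤r ⟩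
          fun A r                  ≡⟨ JK.comp-above α α' u (above-j e≤r) ⟩
          fun α r                  ≡⟨ IK.comp-above α β αβ e≤r ⟨
          fun H r                  ≡⟨ JK.comp-above H H' z (above-j e≤r) ⟨
          fun (JK.comp H H' z) r   ∎

  hcomp-assoc : ∀ α β γ αβ [αβ]γ βγ α[βγ] →
                hcomp (hcomp α β αβ) γ [αβ]γ ≈[ k ] hcomp α (hcomp β γ βγ) α[βγ]
  hcomp-assoc α β γ αβ [αβ]γ βγ α[βγ] = IK.comp-assoc α β γ
    (hComposable⇒composable α β αβ) (hComposable⇒composable (hcomp α β αβ) γ [αβ]γ)
    (hComposable⇒composable β γ βγ) (hComposable⇒composable α (hcomp β γ βγ) α[βγ])

  isStrict2Cat : IsStrict2Cat (Cell i) (Cell j) (Cell k) (_≈[ i ]_) (_≈[ j ]_) (_≈[ k ]_)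
  isStrict2Cat = record
    { ≈₀-isEquivalence = ≈-isEquivalence i
    ; ≈₁-isEquivalence = ≈-isEquivalence j
    ; ≈₂-isEquivalence = ≈-isEquivalence k
    ; src₁ = IJ.src ; tgt₁ = IJ.tgt ; id₁ = IJ.id
    ; src₂ = JK.src ; tgt₂ = JK.tgt ; id₂ = JK.id
    ; comp₁ = IJ.comp ; vcomp = JK.comp ; hcomp = hcomp
    ; src₁-cong = λ {f} {g} → IJ.src-cong {f} {g}
    ; tgt₁-cong = λ {f} {g} → IJ.tgt-cong {f} {g}
    ; id₁-cong  = λ {a} {b} → IJ.id-cong {a} {b}
    ; src₂-cong = λ {α} {β} → JK.src-cong {α} {β}
    ; tgt₂-cong = λ {α} {β} → JK.tgt-cong {α} {β}
    ; id₂-cong  = λ {f} {g} → JK.id-cong {f} {g}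
    ; comp₁-cong = IJ.comp-cong ; vcomp-cong = JK.comp-cong ; hcomp-cong = hcomp-cong
    ; glob-src = glob-src ; glob-tgt = glob-tgt
    ; src₁-id₁ = IJ.src-id ; tgt₁-id₁ = IJ.tgt-id
    ; src₂-id₂ = JK.src-id ; tgt₂-id₂ = JK.tgt-id
    ; src₁-comp₁ = IJ.src-comp ; tgt₁-comp₁ = IJ.tgt-comp
    ; comp₁-assoc = IJ.comp-assoc ; comp₁-idˡ = IJ.comp-idˡ ; comp₁-idʳ = IJ.comp-idʳ
    ; src₂-vcomp = JK.src-comp ; tgt₂-vcomp = JK.tgt-comp
    ; vcomp-assoc = JK.comp-assoc ; vcomp-idˡ = JK.comp-idˡ ; vcomp-idʳ = JK.comp-idʳ
    ; src₂-hcomp = src-hcomp ; tgt₂-hcomp = tgt-hcomp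
    ; hcomp-id₂ = hcomp-id
    ; interchange = λ α α' β β' u v w x y z → Interchange.interchange α α' β β' u v w x y z
    ; hcomp-assoc = hcomp-assoc
    ; hcomp-idˡ = hcomp-idˡ ; hcomp-idʳ = hcomp-idʳ
    }

mainTheorem12 : ∀ {c ℓ : Level} (D : DPoset c ℓ) (i j k : ℕ) → i < j → j < k →
    let open DPoset D using (Carrier)
        open Cells D
    in Σ (IsStrict2Cat (Cell i) (Cell j) (Cell k) (_≈[ i ]_) (_≈[ j ]_) (_≈[ k ]_)) λ S →
       let open IsStrict2Cat S
       in (∀ f r → r ≤ 2 * i → fun (src₁ f) r ≡ sRaw i j (fun f) r)
        × (∀ f r → r ≤ 2 * i → fun (tgt₁ f) r ≡ tRaw i j (fun f) r)
        × (∀ x r → r ≤ 2 * j → fun (id₁ x) r ≡ IdRaw i j (fun x) r)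
        × (∀ α r → r ≤ 2 * j → fun (src₂ α) r ≡ sRaw j k (fun α) r)
        × (∀ α r → r ≤ 2 * j → fun (tgt₂ α) r ≡ tRaw j k (fun α) r)
        × (∀ f r → r ≤ 2 * k → fun (id₂ f) r ≡ IdRaw j k (fun f) r)
        × (∀ f g p r → r ≤ 2 * j → CompSpec i j (fun f) (fun g) (fun (comp₁ f g p)) r)
        × (∀ α β p r → r ≤ 2 * k → CompSpec j k (fun α) (fun β) (fun (vcomp α β p)) r)
        × (∀ α β p r → r ≤ 2 * k → CompSpec i k (fun α) (fun β) (fun (hcomp α β p)) r)
mainTheorem12 D i j k i<j j<k = isStrict2Cat
  , (λ f r _ → if-float (fun f) (r ≤ᵇ i))
  , (λ f r _ → if-float (fun f) (r <ᵇ i))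
  , (λ a r _ → sym (IJ.IdRaw-ψ (fun a) r))
  , (λ α r _ → if-float (fun α) (r ≤ᵇ j))
  , (λ α r _ → if-float (fun α) (r <ᵇ j))
  , (λ f r _ → sym (JK.IdRaw-ψ (fun f) r))
  , (λ f g fg r _ → IJ.comp-spec f g fg r)
  , (λ α β αβ r _ → JK.comp-spec α β αβ r)
  , (λ α β αβ r _ → IK.comp-spec α β (hComposable⇒composable α β αβ) r)
  where
  open Cells D
  open StrictTwoCategory D i j k i<j j<k
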